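{- Let $V$ be a finite set with $n=|V|$, let $d\le 3$ be a nonnegative integer, and let $f:2^V\to\{0,1,\dots,d\}$ be a posimodular function with $f(\emptyset)=0$. Then there exists a semi-extreme set $X$ of $f$ with $|X|=2$, or there exists a nonempty $Y\subseteq V$ with $f(Y)=\min\{f(Z)\mid \emptyset\ne Z\subseteq V\}$ and $|Y|=1$ or $|Y|\ge n-1$.
   Context: A set function $f:2^V\to\mathbb{R}$ is posimodular if $f(X)+f(Y)\ge f(X\setminus Y)+f(Y\setminus X)$ for all $X,Y\subseteq V$. A nonempty subset $X\subseteq V$ is semi-extreme (w.r.t. $f$) if every nonempty subset $Y$ of $X$ satisfies $f(Y)\ge f(X)$. -}

module Defs where

open import Data.Nat using (ℕ; _+_; _≤_)
open import Data.Fin.Subset using (Subset; _─_; _⊆_; Nonempty)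
open import Data.Product using (_×_)

Posimodular : ∀ {n} → (Subset n → ℕ) → Set
Posimodular f = ∀ X Y → f (X ─ Y) + f (Y ─ X) ≤ f X + f Y

SemiExtreme : ∀ {n} → (Subset n → ℕ) → Subset n → Set
SemiExtreme f X = Nonempty X × (∀ Y → Y ⊆ X → Nonempty Y → f X ≤ f Y)

-- Let S be a nonempty minimiser of f, with value λ. If |S| ≤ 1 or |V ∖ S| ≤ 1, S itself
-- is the required minimiser. Otherwise pick a pair P ⊆ S and a pair Q ⊆ V ∖ S. A singleton
-- of value ≤ λ is a minimiser, so we may assume singletons have value ≥ λ + 1; a pair whose
-- value does not exceed those of its two singletons is semi-extreme, so we may assume
-- f P, f Q ≥ λ + 2. Posimodularity applied to S and Y = (S ∖ P) ∪ Q, for which S ∖ Y = P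
-- and Y ∖ S = Q, gives 2λ + 4 ≤ f P + f Q ≤ f S + f Y ≤ λ + 3, a contradiction.
module Submission where

open import Defs
open import Data.Empty using (⊥-elim)
open import Data.Fin using (Fin; zero; suc)
open import Data.Fin.Subset
  using (Subset; ⊥; ⊤; ⁅_⁆; ∁; _∪_; _─_; _-_; _∈_; _∉_; _⊆_; ∣_∣; Nonempty; inside; outside)
open import Data.Fin.Subset.Properties
  using ( _∈?_; nonempty?; anySubset?; Empty-unique; ∣⊥∣≡0; ∈⊤; x∈⁅x⁆; x∈⁅y⁆⇒x≡y
        ; x∉⁅y⁆⇒x≢y; ∣⁅x⁆∣≡1; ⊆-antisym; p⊆q⇒∣p∣≤∣q∣; x∈∁p⇒x∉p; ∣∁p∣≡n∸∣p∣
        ; ∪-comm; ∪-identityˡ; ∪-identityʳ; x∈p∪q⁻; x∈p∪q⁺; x∈p∧x∉q⇒x∈p─q; p─q⊆p; drop-there)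
open import Data.Nat using (ℕ; suc; _+_; _∸_; _≤_; _<_; _≤?_; _<?_; z≤n; s≤s)
open import Data.Nat.Induction using (<-wellFounded)
open import Data.Nat.Properties
  using ( ≤-refl; ≤-trans; ≤-reflexive; ≤-antisym; ≰⇒>; ≮⇒≥; <⇒≱; n<1+n; m≤m+n
        ; +-comm; +-mono-≤; +-monoˡ-≤; +-monoʳ-≤; m≤n+m∸n; m≤n+o⇒m∸n≤o; module ≤-Reasoning)
open import Data.Product using (Σ; ∃; ∃₂; _×_; _,_; proj₂)
open import Data.Vec using (_∷_; here; there)
open import Data.Sum using (_⊎_; inj₁; inj₂)
open import Function using (_∘_)
open import Induction.WellFounded using (Acc; acc)
open import Relation.Binary.PropositionalEquality using (_≡_; _≢_; refl; sym; trans; cong; subst; subst₂)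
open import Relation.Nullary using (yes; no)
open import Relation.Nullary.Decidable using (_×-dec_)
open import Relation.Unary using (Pred; Decidable)

private
  variable
    n : ℕ
    x y : Fin n
    p Z : Subset n

minimiser : ∀ {ℓ} {P : Pred (Subset n) ℓ} → Decidable P → (f : Subset n → ℕ) →
            ∃ P → ∃ λ S → P S × (∀ Z → P Z → f S ≤ f Z)
minimiser {P = P} P? f (Z , PZ) = descend Z PZ (<-wellFounded (f Z))
  where
  descend : ∀ Z → P Z → Acc _<_ (f Z) → ∃ λ S → P S × (∀ Z → P Z → f S ≤ f Z)
  descend Z PZ (acc rs) with anySubset? (λ W → P? W ×-dec f W <? f Z)
  ... | yes (W , PW , fW<fZ) = descend W PW (rs fW<fZ)
  ... | no ∄smaller = Z , PZ , λ W PW → ≮⇒≥ (λ fW<fZ → ∄smaller (W , PW , fW<fZ))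

x∈p─q⁻ : ∀ (p q : Subset n) → x ∈ p ─ q → x ∈ p × x ∉ q
x∈p─q⁻            (inside ∷ p)  (outside ∷ q) here = here , λ ()
x∈p─q⁻ {x = zero} (outside ∷ p) (outside ∷ q) ()
x∈p─q⁻ {x = zero} (_ ∷ p)       (inside ∷ q)  ()
x∈p─q⁻            (_ ∷ p)       (_ ∷ q)       (there x∈p─q) with x∈p─q⁻ p q x∈p─q
... | x∈p , x∉q = there x∈p , x∉q ∘ drop-there

⁅x⁆⊆p : x ∈ p → ⁅ x ⁆ ⊆ p
⁅x⁆⊆p {x = x} x∈p y∈⁅x⁆ rewrite x∈⁅y⁆⇒x≡y x y∈⁅x⁆ = x∈p

nonempty⇒1≤∣p∣ : Nonempty p → 1 ≤ ∣ p ∣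
nonempty⇒1≤∣p∣ (x , x∈p) = ≤-trans (≤-reflexive (sym (∣⁅x⁆∣≡1 x))) (p⊆q⇒∣p∣≤∣q∣ (⁅x⁆⊆p x∈p))

∣p∣≤1⊎two-elements : (p : Subset n) → ∣ p ∣ ≤ 1 ⊎ ∃₂ λ x y → x ≢ y × x ∈ p × y ∈ p
∣p∣≤1⊎two-elements {n} p with nonempty? p
... | no p≡∅ = inj₁ (≤-trans (≤-reflexive (trans (cong ∣_∣ (Empty-unique p≡∅)) (∣⊥∣≡0 n))) z≤n)
... | yes (x , x∈p) with nonempty? (p - x)
...   | yes (y , y∈p-x) =
  let y∈p , y∉⁅x⁆ = x∈p─q⁻ p ⁅ x ⁆ y∈p-x in inj₂ (y , x , x∉⁅y⁆⇒x≢y y∉⁅x⁆ , y∈p , x∈p)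
...   | no p-x≡∅ = inj₁ (≤-trans (p⊆q⇒∣p∣≤∣q∣ p⊆⁅x⁆) (≤-reflexive (∣⁅x⁆∣≡1 x)))
  where
  p⊆⁅x⁆ : p ⊆ ⁅ x ⁆
  p⊆⁅x⁆ {y} y∈p with y ∈? ⁅ x ⁆
  ... | yes y∈⁅x⁆ = y∈⁅x⁆
  ... | no y∉⁅x⁆ = ⊥-elim (p-x≡∅ (y , x∈p∧x∉q⇒x∈p─q y∈p y∉⁅x⁆))

∣∁p∣≤1⇒n∸1≤∣p∣ : (p : Subset n) → ∣ ∁ p ∣ ≤ 1 → n ∸ 1 ≤ ∣ p ∣
∣∁p∣≤1⇒n∸1≤∣p∣ {n} p ∣∁p∣≤1 = m≤n+o⇒m∸n≤o n 1 (begin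
  n                    ≤⟨ m≤n+m∸n n ∣ p ∣ ⟩
  ∣ p ∣ + (n ∸ ∣ p ∣)  ≡⟨ cong (∣ p ∣ +_) (sym (∣∁p∣≡n∸∣p∣ p)) ⟩
  ∣ p ∣ + ∣ ∁ p ∣      ≤⟨ +-monoʳ-≤ ∣ p ∣ ∣∁p∣≤1 ⟩
  ∣ p ∣ + 1            ≡⟨ +-comm ∣ p ∣ 1 ⟩
  1 + ∣ p ∣            ∎)
  where open ≤-Reasoning

∣⁅x⁆∪⁅y⁆∣≡2 : x ≢ y → ∣ ⁅ x ⁆ ∪ ⁅ y ⁆ ∣ ≡ 2
∣⁅x⁆∪⁅y⁆∣≡2 {x = zero}  {zero}  x≢y = ⊥-elim (x≢y refl)
∣⁅x⁆∪⁅y⁆∣≡2 {x = zero}  {suc y} _ rewrite ∪-identityˡ ⁅ y ⁆ = cong suc (∣⁅x⁆∣≡1 y)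
∣⁅x⁆∪⁅y⁆∣≡2 {x = suc x} {zero}  _ rewrite ∪-identityʳ ⁅ x ⁆ = cong suc (∣⁅x⁆∣≡1 x)
∣⁅x⁆∪⁅y⁆∣≡2 {x = suc x} {suc y} x≢y = ∣⁅x⁆∪⁅y⁆∣≡2 (x≢y ∘ cong suc)

x∈⁅y⁆∪⁅z⁆⁻ : ∀ {z} → x ∈ ⁅ y ⁆ ∪ ⁅ z ⁆ → x ≡ y ⊎ x ≡ z
x∈⁅y⁆∪⁅z⁆⁻ {y = y} {z} x∈ with x∈p∪q⁻ ⁅ y ⁆ ⁅ z ⁆ x∈
... | inj₁ x∈⁅y⁆ = inj₁ (x∈⁅y⁆⇒x≡y y x∈⁅y⁆)
... | inj₂ x∈⁅z⁆ = inj₂ (x∈⁅y⁆⇒x≡y z x∈⁅z⁆)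

⁅x⁆∪⁅y⁆⊆p : x ∈ p → y ∈ p → ⁅ x ⁆ ∪ ⁅ y ⁆ ⊆ p
⁅x⁆∪⁅y⁆⊆p x∈p y∈p z∈ with x∈⁅y⁆∪⁅z⁆⁻ z∈
... | inj₁ refl = x∈p
... | inj₂ refl = y∈p

⊆⁅x⁆∪⁅y⁆∧y∉⇒⊆⁅x⁆ : Z ⊆ ⁅ x ⁆ ∪ ⁅ y ⁆ → y ∉ Z → Z ⊆ ⁅ x ⁆
⊆⁅x⁆∪⁅y⁆∧y∉⇒⊆⁅x⁆ Z⊆ y∉Z z∈Z with x∈⁅y⁆∪⁅z⁆⁻ (Z⊆ z∈Z)
... | inj₁ refl = x∈⁅x⁆ _
... | inj₂ refl = ⊥-elim (y∉Z z∈Z)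

nonempty-⊆⁅x⁆∪⁅y⁆ : Z ⊆ ⁅ x ⁆ ∪ ⁅ y ⁆ → Nonempty Z →
                    Z ≡ ⁅ x ⁆ ⊎ Z ≡ ⁅ y ⁆ ⊎ Z ≡ ⁅ x ⁆ ∪ ⁅ y ⁆
nonempty-⊆⁅x⁆∪⁅y⁆ {Z = Z} {x} {y} Z⊆ (z , z∈Z) with x ∈? Z | y ∈? Z
... | yes x∈Z | yes y∈Z = inj₂ (inj₂ (⊆-antisym Z⊆ (⁅x⁆∪⁅y⁆⊆p x∈Z y∈Z)))
... | yes x∈Z | no y∉Z  = inj₁ (⊆-antisym (⊆⁅x⁆∪⁅y⁆∧y∉⇒⊆⁅x⁆ Z⊆ y∉Z) (⁅x⁆⊆p x∈Z))
... | no x∉Z  | yes y∈Z =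
  inj₂ (inj₁ (⊆-antisym (⊆⁅x⁆∪⁅y⁆∧y∉⇒⊆⁅x⁆ (subst (Z ⊆_) (∪-comm ⁅ x ⁆ ⁅ y ⁆) Z⊆) x∉Z) (⁅x⁆⊆p y∈Z)))
... | no x∉Z  | no y∉Z with x∈⁅y⁆∪⁅z⁆⁻ (Z⊆ z∈Z)
...   | inj₁ refl = ⊥-elim (x∉Z z∈Z)
...   | inj₂ refl = ⊥-elim (y∉Z z∈Z)

⁅x⁆∪⁅y⁆-semiExtreme : (f : Subset n → ℕ) → f (⁅ x ⁆ ∪ ⁅ y ⁆) ≤ f ⁅ x ⁆ →
                      f (⁅ x ⁆ ∪ ⁅ y ⁆) ≤ f ⁅ y ⁆ → SemiExtreme f (⁅ x ⁆ ∪ ⁅ y ⁆)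
⁅x⁆∪⁅y⁆-semiExtreme {x = x} {y} f ≤fx ≤fy = (x , x∈p∪q⁺ (inj₁ (x∈⁅x⁆ x))) , ≤f
  where
  ≤f : ∀ Z → Z ⊆ ⁅ x ⁆ ∪ ⁅ y ⁆ → Nonempty Z → f (⁅ x ⁆ ∪ ⁅ y ⁆) ≤ f Z
  ≤f Z Z⊆ Z≢∅ with nonempty-⊆⁅x⁆∪⁅y⁆ Z⊆ Z≢∅
  ... | inj₁ refl        = ≤fx
  ... | inj₂ (inj₁ refl) = ≤fy
  ... | inj₂ (inj₂ refl) = ≤-refl

module _ {S P Q : Subset n} (P⊆S : P ⊆ S) (Q⊆∁S : Q ⊆ ∁ S) where

  private
    Y : Subset n
    Y = (S ─ P) ∪ Q

    S─Y≡P : S ─ Y ≡ P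
    S─Y≡P = ⊆-antisym S─Y⊆P P⊆S─Y
      where
      S─Y⊆P : S ─ Y ⊆ P
      S─Y⊆P {x} x∈S─Y with x∈p─q⁻ S Y x∈S─Y | x ∈? P
      ... | _ , _ | yes x∈P = x∈P
      ... | x∈S , x∉Y | no x∉P = ⊥-elim (x∉Y (x∈p∪q⁺ (inj₁ (x∈p∧x∉q⇒x∈p─q x∈S x∉P))))
      P⊆S─Y : P ⊆ S ─ Y
      P⊆S─Y {x} x∈P = x∈p∧x∉q⇒x∈p─q (P⊆S x∈P) x∉Y
        where
        x∉Y : x ∉ Y
        x∉Y x∈Y with x∈p∪q⁻ (S ─ P) Q x∈Y
        ... | inj₁ x∈S─P = proj₂ (x∈p─q⁻ S P x∈S─P) x∈P
        ... | inj₂ x∈Q = x∈∁p⇒x∉p (Q⊆∁S x∈Q) (P⊆S x∈P)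

    Y─S≡Q : Y ─ S ≡ Q
    Y─S≡Q = ⊆-antisym Y─S⊆Q (λ x∈Q → x∈p∧x∉q⇒x∈p─q (x∈p∪q⁺ (inj₂ x∈Q)) (x∈∁p⇒x∉p (Q⊆∁S x∈Q)))
      where
      Y─S⊆Q : Y ─ S ⊆ Q
      Y─S⊆Q x∈Y─S with x∈p─q⁻ Y S x∈Y─S
      ... | x∈Y , x∉S with x∈p∪q⁻ (S ─ P) Q x∈Y
      ...   | inj₁ x∈S─P = ⊥-elim (x∉S (p─q⊆p S P x∈S─P))
      ...   | inj₂ x∈Q = x∈Q

  posimodular-exchange : (f : Subset n → ℕ) → Posimodular f → f P + f Q ≤ f S + f ((S ─ P) ∪ Q)
  posimodular-exchange f pm = subst₂ (λ A B → f A + f B ≤ f S + f Y) S─Y≡P Y─S≡Q (pm S Y)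

module _ (f : Subset n → ℕ) (S : Subset n) (S≢∅ : Nonempty S)
         (S-min : ∀ Z → Nonempty Z → f S ≤ f Z) where

  Conclusion : Set
  Conclusion = (Σ (Subset n) λ X → SemiExtreme f X × ∣ X ∣ ≡ 2)
             ⊎ (Σ (Subset n) λ Y → Nonempty Y × (∀ Z → Nonempty Z → f Y ≤ f Z)
                  × (∣ Y ∣ ≡ 1 ⊎ n ∸ 1 ≤ ∣ Y ∣))

  conclusion⊎f⁅x⁆>min : ∀ x → Conclusion ⊎ f S < f ⁅ x ⁆
  conclusion⊎f⁅x⁆>min x with f ⁅ x ⁆ ≤? f S
  ... | yes fx≤fS = inj₁ (inj₂ (⁅ x ⁆ , (x , x∈⁅x⁆ x) , (λ Z Z≢∅ → ≤-trans fx≤fS (S-min Z Z≢∅))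
                                , inj₁ (∣⁅x⁆∣≡1 x)))
  ... | no fx≰fS = inj₂ (≰⇒> fx≰fS)

  conclusion⊎f⁅x⁆∪⁅y⁆≥2+min : x ≢ y → Conclusion ⊎ 2 + f S ≤ f (⁅ x ⁆ ∪ ⁅ y ⁆)
  conclusion⊎f⁅x⁆∪⁅y⁆≥2+min {x} {y} x≢y with conclusion⊎f⁅x⁆>min x | conclusion⊎f⁅x⁆>min y
  ... | inj₁ c | _      = inj₁ c
  ... | inj₂ _ | inj₁ c = inj₁ c
  ... | inj₂ fS<fx | inj₂ fS<fy with f (⁅ x ⁆ ∪ ⁅ y ⁆) ≤? f ⁅ x ⁆ | f (⁅ x ⁆ ∪ ⁅ y ⁆) ≤? f ⁅ y ⁆
  ...   | yes ≤fx | yes ≤fy = inj₁ (inj₁ (⁅ x ⁆ ∪ ⁅ y ⁆ , ⁅x⁆∪⁅y⁆-semiExtreme f ≤fx ≤fy , ∣⁅x⁆∪⁅y⁆∣≡2 x≢y))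
  ...   | no ≰fx  | _       = inj₂ (≤-trans (s≤s fS<fx) (≰⇒> ≰fx))
  ...   | yes _   | no ≰fy  = inj₂ (≤-trans (s≤s fS<fy) (≰⇒> ≰fy))

  conclusion : (∀ X → f X ≤ 3) → Posimodular f → Conclusion
  conclusion f≤3 pm with ∣p∣≤1⊎two-elements S | ∣p∣≤1⊎two-elements (∁ S)
  ... | inj₁ ∣S∣≤1 | _ = inj₂ (S , S≢∅ , S-min , inj₁ (≤-antisym ∣S∣≤1 (nonempty⇒1≤∣p∣ S≢∅)))
  ... | inj₂ _ | inj₁ ∣∁S∣≤1 = inj₂ (S , S≢∅ , S-min , inj₂ (∣∁p∣≤1⇒n∸1≤∣p∣ S ∣∁S∣≤1))
  ... | inj₂ (s , t , s≢t , s∈S , t∈S) | inj₂ (u , w , u≢w , u∈∁S , w∈∁S)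
    with conclusion⊎f⁅x⁆∪⁅y⁆≥2+min s≢t | conclusion⊎f⁅x⁆∪⁅y⁆≥2+min u≢w
  ...   | inj₁ c | _      = c
  ...   | inj₂ _ | inj₁ c = c
  ...   | inj₂ fP≥2+fS | inj₂ fQ≥2+fS = ⊥-elim (<⇒≱ fS+fY<fP+fQ
            (posimodular-exchange (⁅x⁆∪⁅y⁆⊆p s∈S t∈S) (⁅x⁆∪⁅y⁆⊆p u∈∁S w∈∁S) f pm))
    where
    open ≤-Reasoning
    P Q Y : Subset n
    P = ⁅ s ⁆ ∪ ⁅ t ⁆
    Q = ⁅ u ⁆ ∪ ⁅ w ⁆
    Y = (S ─ P) ∪ Q
    fS+fY<fP+fQ : f S + f Y < f P + f Q
    fS+fY<fP+fQ = begin-strict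
      f S + f Y              ≤⟨ +-monoʳ-≤ (f S) (f≤3 Y) ⟩
      f S + 3                ≡⟨ +-comm (f S) 3 ⟩
      3 + f S                <⟨ n<1+n _ ⟩
      2 + (2 + f S)          ≤⟨ +-monoˡ-≤ (2 + f S) (m≤m+n 2 (f S)) ⟩
      (2 + f S) + (2 + f S)  ≤⟨ +-mono-≤ fP≥2+fS fQ≥2+fS ⟩
      f P + f Q              ∎

lemma5 : (n : ℕ) → 1 ≤ n → (d : ℕ) → d ≤ 3 → (f : Subset n → ℕ) →
         (∀ X → f X ≤ d) → Posimodular f → f ⊥ ≡ 0 →
         (Σ (Subset n) λ X → SemiExtreme f X × ∣ X ∣ ≡ 2)
         ⊎ (Σ (Subset n) λ Y → Nonempty Y × (∀ Z → Nonempty Z → f Y ≤ f Z)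
              × (∣ Y ∣ ≡ 1 ⊎ n ∸ 1 ≤ ∣ Y ∣))
lemma5 (suc _) _ _ d≤3 f f≤d pm _ =
  let S , S≢∅ , S-min = minimiser nonempty? f (⊤ , zero , ∈⊤) in
  conclusion f S S≢∅ S-min (λ X → ≤-trans (f≤d X) d≤3) pm
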